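{- Let $G$ be a finite simple 1-plane graph and let $G^\times$ be its associated plane graph. If $v$ is a true vertex of $G^\times$ with $d_{G^\times}(v)=4$, then $v$ is incident with at most three false faces of $G^\times$ of degree $3$.
   Context: A graph is 1-planar if it can be drawn in the plane so that each edge is crossed by at most one other edge; a 1-plane graph is such a drawing of a 1-planar graph in which the number of crossings is as small as possible. The associated plane graph $G^\times$ of a 1-plane graph $G$ is the plane graph obtained from $G$ by turning every crossing of $G$ into a new vertex of degree four; these new vertices are called false vertices of $G^\times$, and the original vertices of $G$ are called true vertices of $G^\times$. A face of $G^\times$ is false if it is incident with at least one false vertex. The degree of a face is the length of its boundary walk; a 3-face is a face of degree 3. -}

module Defs where

open import Data.Nat using (ℕ; zero; suc; _+_; _*_; _≤_; _<_; _≤ᵇ_)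
open import Data.Bool using (Bool; true; false; _∧_; _∨_; not; if_then_else_)
open import Data.Fin using (Fin; toℕ; _≟_)
open import Data.Maybe using (Maybe; just; nothing; is-just; is-nothing)
open import Data.List using (List; []; _∷_; allFin; upTo)
open import Data.Product using (Σ; _×_; _,_)
open import Relation.Nullary using (¬_)
open import Relation.Nullary.Decidable using (⌊_⌋)
open import Relation.Binary.PropositionalEquality using (_≡_; _≢_)

iter : ∀ {A : Set} → (A → A) → ℕ → A → A
iter f zero    x = x
iter f (suc k) x = f (iter f k x)

SameOrbit : ∀ {A : Set} → (A → A) → A → A → Set
SameOrbit f x y = Σ ℕ λ k → iter f k x ≡ y

OrbitLength : ∀ {A : Set} → (A → A) → A → ℕ → Set
OrbitLength f x l =
  (0 < l) × (iter f l x ≡ x) × (∀ i → 0 < i → i < l → iter f i x ≢ x)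

countB : ∀ {A : Set} → (A → Bool) → List A → ℕ
countB p []       = 0
countB p (x ∷ xs) = if p x then suc (countB p xs) else countB p xs

allB : ∀ {A : Set} → (A → Bool) → List A → Bool
allB p []       = true
allB p (x ∷ xs) = p x ∧ allB p xs

_==_ : ∀ {d} → Fin d → Fin d → Bool
x == y = ⌊ x ≟ y ⌋

leastInCycle : ∀ {d} → (Fin d → Fin d) → Fin d → Bool
leastInCycle {d} f x = allB (λ k → toℕ x ≤ᵇ toℕ (iter f k x)) (upTo d)

#cycles : ∀ {d} → (Fin d → Fin d) → ℕ
#cycles {d} f = countB (leastInCycle f) (allFin d)

reach : ∀ {d} → (Fin d → Fin d) → (Fin d → Fin d) → ℕ → Fin d → Fin d → Bool
reach σ α zero    x y = x == y
reach σ α (suc k) x y = reach σ α k x y ∨ reach σ α k (σ x) y ∨ reach σ α k (α x) y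

#components : ∀ {d} → (Fin d → Fin d) → (Fin d → Fin d) → ℕ
#components {d} σ α =
  countB (λ x → allB (λ y → not (reach σ α d y x) ∨ (toℕ x ≤ᵇ toℕ y)) (allFin d))
         (allFin d)

record SimpleGraph (n : ℕ) : Set₁ where
  field
    Adj     : Fin n → Fin n → Set
    symm    : ∀ {u w} → Adj u w → Adj w u
    irrefl  : ∀ {u} → ¬ Adj u u

-- 1-planar drawings of G, given combinatorially through the associated
-- plane graph G^× as a plane combinatorial map (rotation system):
--   darts Fin d, α = edge reversal (fixed-point-free involution),
--   σ = rotation at vertices (permutation); vertices = σ-cycles,
--   faces = cycles of φ = σ ∘ α (boundary walks), genus 0 on every
--   component (Euler: V - E + F = 2 per component, summed).
-- lab x = just u  : the vertex of dart x is the true vertex u of G,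
-- lab x = nothing : the vertex of dart x is a false vertex (a crossing).

-- for a dart x at a true vertex: the dart at the other true end of the
-- G-edge drawn starting with x (passing straight through a crossing if any;
-- at a crossing the edge continues with the opposite dart σ²)
farEnd : ∀ {d n : ℕ} → (Fin d → Fin d) → (Fin d → Fin d) → (Fin d → Maybe (Fin n)) → Fin d → Fin d
farEnd σ α lab x with lab (α x)
... | just _  = α x
... | nothing = α (σ (σ (α x)))

record Drawing {n : ℕ} (G : SimpleGraph n) : Set where
  open SimpleGraph G
  field
    d      : ℕ
    σ      : Fin d → Fin d
    α      : Fin d → Fin d
    lab    : Fin d → Maybe (Fin n)
    σ-inj  : ∀ {x y} → σ x ≡ σ y → x ≡ y
    α-inv  : ∀ x → α (α x) ≡ x
    α-fpf  : ∀ x → α x ≢ x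
    -- plane: V - E + F = 2 on each component, i.e. 2V + 2F = d + 4C
    planar : 2 * #cycles σ + 2 * #cycles (λ x → σ (α x)) ≡ d + 4 * #components σ α
    lab-σ       : ∀ x → lab (σ x) ≡ lab x
    lab-uniq    : ∀ {x y u} → lab x ≡ just u → lab y ≡ just u → SameOrbit σ x y
    false-deg4  : ∀ x → lab x ≡ nothing → OrbitLength σ x 4
    -- ... and are adjacent only to true vertices (each edge crossed at most once)
    false-nbr   : ∀ x → lab x ≡ nothing → is-just (lab (α x)) ≡ true
    -- the drawn edges are exactly the edges of G, each drawn once:
    -- x ↦ (name of x, name of farEnd x) is a bijection from true darts onto
    -- ordered pairs of adjacent vertices of G

    edge-sound  : ∀ x {u w} → lab x ≡ just u → lab (farEnd σ α lab x) ≡ just w → Adj u w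
    edge-compl  : ∀ {u w} → Adj u w → Σ (Fin d) λ x → (lab x ≡ just u) × (lab (farEnd σ α lab x) ≡ just w)
    edge-inj    : ∀ x y {u w} → lab x ≡ just u → lab y ≡ just u →
                  lab (farEnd σ α lab x) ≡ just w → lab (farEnd σ α lab y) ≡ just w → x ≡ y

  φ : Fin d → Fin d
  φ x = σ (α x)

  crossings : ℕ
  crossings = countB (λ x → is-nothing (lab x) ∧ leastInCycle σ x) (allFin d)

  TrueDart : Fin d → Set
  TrueDart x = is-just (lab x) ≡ true

  VertexDegree : Fin d → ℕ → Set
  VertexDegree x k = OrbitLength σ x k

  FaceDegree : Fin d → ℕ → Set
  FaceDegree y k = OrbitLength φ y k

  FalseFace : Fin d → Set
  FalseFace y = Σ ℕ λ i → lab (iter φ i y) ≡ nothing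

  Incident : Fin d → Fin d → Set
  Incident x y = Σ ℕ λ i → SameOrbit σ x (iter φ i y)

  SameFace : Fin d → Fin d → Set
  SameFace y y' = SameOrbit φ y y'

IsOnePlane : ∀ {n} {G : SimpleGraph n} → Drawing G → Set
IsOnePlane {G = G} D = ∀ (D' : Drawing G) → Drawing.crossings D ≤ Drawing.crossings D'

{-# OPTIONS --safe #-}
-- Let y₀, y₁, y₂, y₃ be the darts of the degree-4 vertex v in rotation order. The
-- face at the corner between yᵢ₋₁ and yᵢ is a triangle with third dart α yᵢ₋₁, and
-- it is false exactly when the neighbour along yᵢ₋₁ or along yᵢ is a crossing. Two
-- crossings are never adjacent, so four false triangles force the crossings to be
-- the neighbours along two opposite darts, say y₁ and y₃. The triangles then put
-- both crossings on an edge joining the true neighbours along y₂ and y₀; as G is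
-- simple this is one edge, hence one crossing, and the edge leaving v along y₁
-- returns to v along y₃: a loop.
module Submission where

open import Defs
open import Data.Nat using (ℕ; zero; suc; _+_; _*_; _≤_; NonZero)
open import Data.Nat.Properties using (+-comm; *-suc)
open import Data.Nat.DivMod using (_divMod_; result)
open import Data.Bool using (true)
open import Data.Fin using (Fin; zero; suc; toℕ; punchOut; _≟_)
open import Data.Fin.Properties using (all?; any?; ¬∀⟶∃¬; punchOut-injective; injective⇒≤)
open import Data.Maybe using (Maybe; just; nothing; is-just)
open import Data.Product using (Σ; ∃; _,_; proj₁; proj₂)
open import Data.Sum using (_⊎_; inj₁; inj₂; [_,_]′)
open import Data.Empty using (⊥; ⊥-elim)
open import Function using (id)
open import Function.Definitions using (Injective)
open import Relation.Nullary using (yes; no)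
open import Relation.Binary.PropositionalEquality
open ≡-Reasoning

module _ {A : Set} (f : A → A) where

  iter-+ : ∀ m n x → iter f (m + n) x ≡ iter f m (iter f n x)
  iter-+ zero    n x = refl
  iter-+ (suc m) n x = cong f (iter-+ m n x)

  iter-*-periodic : ∀ {l x} → iter f l x ≡ x → ∀ q → iter f (q * l) x ≡ x
  iter-*-periodic         P zero    = refl
  iter-*-periodic {l} {x} P (suc q) = begin
    iter f (l + q * l) x        ≡⟨ iter-+ l (q * l) x ⟩
    iter f l (iter f (q * l) x) ≡⟨ cong (iter f l) (iter-*-periodic P q) ⟩
    iter f l x                  ≡⟨ P ⟩
    x                           ∎

  sameOrbit-trans : ∀ {x y z} → SameOrbit f x y → SameOrbit f y z → SameOrbit f x z
  sameOrbit-trans {x} (m , refl) (n , refl) = n + m , iter-+ n m x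

  sameOrbit-sym : ∀ {l x y} → iter f (suc l) x ≡ x → SameOrbit f x y → SameOrbit f y x
  sameOrbit-sym {l} {x} P (k , refl) = k * l , (begin
    iter f (k * l) (iter f k x) ≡⟨ iter-+ (k * l) k x ⟨
    iter f (k * l + k) x        ≡⟨ cong (λ m → iter f m x) (trans (+-comm (k * l) k) (sym (*-suc k l))) ⟩
    iter f (k * suc l) x        ≡⟨ iter-*-periodic P k ⟩
    x                           ∎)

  sameOrbit-periodic : ∀ {l x y} → iter f l x ≡ x → SameOrbit f x y → iter f l y ≡ y
  sameOrbit-periodic {l} {x} P (k , refl) = begin
    iter f l (iter f k x) ≡⟨ iter-+ l k x ⟨
    iter f (l + k) x      ≡⟨ cong (λ m → iter f m x) (+-comm l k) ⟩
    iter f (k + l) x      ≡⟨ iter-+ k l x ⟩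
    iter f k (iter f l x) ≡⟨ cong (iter f k) P ⟩
    iter f k x            ∎

  orbit-representative : ∀ {l x y} .{{_ : NonZero l}} → iter f l x ≡ x →
                         SameOrbit f x y → Σ (Fin l) λ r → iter f (toℕ r) x ≡ y
  orbit-representative {l} {x} P (k , refl) with k divMod l
  ... | result q r k≡r+q*l = r , (begin
    iter f (toℕ r) x                  ≡⟨ cong (iter f (toℕ r)) (iter-*-periodic P q) ⟨
    iter f (toℕ r) (iter f (q * l) x) ≡⟨ iter-+ (toℕ r) (q * l) x ⟨
    iter f (toℕ r + q * l) x          ≡⟨ cong (λ m → iter f m x) k≡r+q*l ⟨
    iter f k x                        ∎)

injective⇒surjective⊎≤ : ∀ {j n} {g : Fin j → Fin (suc n)} → Injective _≡_ _≡_ g →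
                         (∀ c → ∃ λ i → g i ≡ c) ⊎ j ≤ n
injective⇒surjective⊎≤ {g = g} g-inj with all? (λ c → any? (λ i → g i ≟ c))
... | yes onto = inj₁ onto
... | no ¬onto with ¬∀⟶∃¬ _ _ (λ c → any? (λ i → g i ≟ c)) ¬onto
...   | c , missed = inj₂ (injective⇒≤ punchOut∘g-inj)
  where
  c≢g : ∀ i → c ≢ g i
  c≢g i e = missed (i , sym e)

  punchOut∘g-inj : Injective _≡_ _≡_ (λ i → punchOut (c≢g i))
  punchOut∘g-inj {i} {i'} e = g-inj (punchOut-injective (c≢g i) (c≢g i') e)

is-just⇒just : ∀ {B : Set} {m : Maybe B} → is-just m ≡ true → ∃ λ b → m ≡ just b
is-just⇒just {m = just b} _ = b , refl

module DrawingProperties {n} {G : SimpleGraph n} (D : Drawing G) where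
  open Drawing D
  open SimpleGraph G

  lab-iter-σ : ∀ k y → lab (iter σ k y) ≡ lab y
  lab-iter-σ zero    y = refl
  lab-iter-σ (suc k) y = trans (lab-σ _) (lab-iter-σ k y)

  crossing-degree : ∀ {a} → lab a ≡ nothing → σ (σ (σ (σ a))) ≡ a
  crossing-degree {a} F = proj₁ (proj₂ (false-deg4 a F))

  σ-preimage-at-crossing : ∀ {a b} → lab a ≡ nothing → σ b ≡ a → b ≡ σ (σ (σ a))
  σ-preimage-at-crossing F σb≡a = σ-inj (trans σb≡a (sym (crossing-degree F)))

  crossing-neighbour-true : ∀ {a} → lab a ≡ nothing → ∃ λ w → lab (α a) ≡ just w
  crossing-neighbour-true {a} F = is-just⇒just (false-nbr a F)

  farEnd-via-crossing : ∀ y → lab (α y) ≡ nothing → farEnd σ α lab y ≡ α (σ (σ (α y)))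
  farEnd-via-crossing y F rewrite F = refl

  farEnd-across-crossing : ∀ b → lab b ≡ nothing → farEnd σ α lab (α (σ b)) ≡ α (σ (σ (σ b)))
  farEnd-across-crossing b F =
    trans (farEnd-via-crossing (α (σ b)) (trans (cong lab (α-inv (σ b))) (trans (lab-σ b) F)))
          (cong (λ z → α (σ (σ z))) (α-inv (σ b)))

  -- The face at the corner between the consecutive darts p and σ p = y is a
  -- triangle y, φ y, α p.
  TriangleCorner : Fin d → Fin d → Set
  TriangleCorner p y = φ (φ y) ≡ α p

  record FalseTriangleCorner (p y : Fin d) : Set where
    field
      triangle : TriangleCorner p y
      crossing : lab (α y) ≡ nothing ⊎ lab (α p) ≡ nothing
  open FalseTriangleCorner

  triangle-corner : ∀ {p y} → σ p ≡ y → iter φ 3 y ≡ y → TriangleCorner p y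
  triangle-corner σp≡y P = trans (sym (α-inv _)) (cong α (σ-inj (trans P (sym σp≡y))))

  false-3-face-corner : ∀ {p y z u} → lab y ≡ just u → σ p ≡ y → SameOrbit φ z y →
                        FaceDegree z 3 → FalseFace z → FalseTriangleCorner p y
  false-3-face-corner {p} {y} {z} ly σp≡y z~y (_ , P , _) (i , F) =
    corner-case (orbit-representative φ P′ (sameOrbit-trans φ (sameOrbit-sym φ {2} P z~y) (i , refl)))
    where
    P′ : iter φ 3 y ≡ y
    P′ = sameOrbit-periodic φ {3} P z~y

    T : TriangleCorner p y
    T = triangle-corner σp≡y P′

    corner-case : Σ (Fin 3) (λ r → iter φ (toℕ r) y ≡ iter φ i z) → FalseTriangleCorner p y
    corner-case (zero , e) with () ← trans (sym ly) (trans (cong lab e) F)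
    corner-case (suc zero , e) = record
      { triangle = T ; crossing = inj₁ (trans (sym (lab-σ _)) (trans (cong lab e) F)) }
    corner-case (suc (suc zero) , e) = record
      { triangle = T ; crossing = inj₂ (trans (cong lab (sym T)) (trans (cong lab e) F)) }

  -- A triangle side joins α y to α p, and crossings are adjacent only to true vertices.
  crossings-not-adjacent : ∀ {p y} → TriangleCorner p y → lab (α y) ≡ nothing → lab (α p) ≡ nothing → ⊥
  crossings-not-adjacent {y = y} T Fy Fp with crossing-neighbour-true (trans (lab-σ (α y)) Fy)
  ... | w , l with () ← trans (sym l) (trans (sym (lab-σ _)) (trans (cong lab T) Fp))

  next-crossing : ∀ {q p y} → FalseTriangleCorner q p → FalseTriangleCorner p y →
                  lab (α q) ≡ nothing → lab (α y) ≡ nothing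
  next-crossing s t Fq with crossing t
  ... | inj₁ Fy = Fy
  ... | inj₂ Fp = ⊥-elim (crossings-not-adjacent (triangle s) Fp Fq)

  previous-crossing : ∀ {q p y} → FalseTriangleCorner q p → FalseTriangleCorner p y →
                      lab (α y) ≡ nothing → lab (α q) ≡ nothing
  previous-crossing s t Fy with crossing s
  ... | inj₁ Fp = ⊥-elim (crossings-not-adjacent (triangle t) Fy Fp)
  ... | inj₂ Fq = Fq

  -- Through the crossings at α y₁ and α y₃ run two edges joining the true ends of
  -- α y₂ and α y₀; since G is simple they are the same edge, so the two crossings coincide.
  opposite-crossings-coincide : ∀ {y₀ y₁ y₂ y₃} →
    TriangleCorner y₃ y₀ → TriangleCorner y₀ y₁ → TriangleCorner y₁ y₂ → TriangleCorner y₂ y₃ →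
    lab (α y₁) ≡ nothing → lab (α y₃) ≡ nothing → σ (σ (α y₁)) ≡ α y₃
  opposite-crossings-coincide {y₀} {y₁} {y₂} {y₃} T₀ T₁ T₂ T₃ F₁ F₃ =
    σ-inj (trans (sym (α-inv _)) (trans (cong α p≡q) (α-inv _)))
    where
    a₀ a₁ a₂ a₃ p q : Fin d
    a₀ = α y₀
    a₁ = α y₁
    a₂ = α y₂
    a₃ = α y₃
    p = α (σ (σ (σ a₁)))
    q = α (σ a₃)

    w₂ : Fin n
    w₂ = proj₁ (crossing-neighbour-true (trans (lab-σ a₃) F₃))
    lab-q : lab q ≡ just w₂
    lab-q = proj₂ (crossing-neighbour-true (trans (lab-σ a₃) F₃))

    lab-p : lab p ≡ lab q
    lab-p = begin
      lab (α (σ (σ (σ a₁)))) ≡⟨ cong (λ z → lab (α z)) (σ-preimage-at-crossing F₁ T₂) ⟨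
      lab (α (α (σ a₂)))     ≡⟨ cong lab (α-inv _) ⟩
      lab (σ a₂)             ≡⟨ lab-σ a₂ ⟩
      lab a₂                 ≡⟨ cong lab T₃ ⟨
      lab (σ q)              ≡⟨ lab-σ q ⟩
      lab q                  ∎

    w₀ : Fin n
    w₀ = proj₁ (crossing-neighbour-true (trans (lab-σ a₁) F₁))
    lab-far-p : lab (farEnd σ α lab p) ≡ just w₀
    lab-far-p = begin
      lab (farEnd σ α lab p)         ≡⟨ cong lab (farEnd-across-crossing (σ (σ a₁)) F₁′) ⟩
      lab (α (σ (σ (σ (σ (σ a₁)))))) ≡⟨ cong (λ z → lab (α (σ z))) (crossing-degree F₁) ⟩
      lab (α (σ a₁))                 ≡⟨ proj₂ (crossing-neighbour-true (trans (lab-σ a₁) F₁)) ⟩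
      just w₀                        ∎
      where
      F₁′ : lab (σ (σ a₁)) ≡ nothing
      F₁′ = trans (lab-σ _) (trans (lab-σ _) F₁)

    lab-far-q : lab (farEnd σ α lab q) ≡ just w₀
    lab-far-q = begin
      lab (farEnd σ α lab q) ≡⟨ cong lab (farEnd-across-crossing a₃ F₃) ⟩
      lab (α (σ (σ (σ a₃)))) ≡⟨ cong (λ z → lab (α z)) (σ-preimage-at-crossing F₃ T₀) ⟨
      lab (α (α (σ a₀)))     ≡⟨ cong lab (α-inv _) ⟩
      lab (σ a₀)             ≡⟨ lab-σ a₀ ⟩
      lab a₀                 ≡⟨ cong lab T₁ ⟨
      lab (σ (α (σ a₁)))     ≡⟨ lab-σ _ ⟩
      lab (α (σ a₁))         ≡⟨ proj₂ (crossing-neighbour-true (trans (lab-σ a₁) F₁)) ⟩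
      just w₀                ∎

    p≡q : p ≡ q
    p≡q = edge-inj p q (trans lab-p lab-q) lab-q lab-far-p lab-far-q

  ¬opposite-crossings : ∀ {y₀ y₁ y₂ y₃ u} →
    TriangleCorner y₃ y₀ → TriangleCorner y₀ y₁ → TriangleCorner y₁ y₂ → TriangleCorner y₂ y₃ →
    lab (α y₁) ≡ nothing → lab (α y₃) ≡ nothing → σ (σ y₁) ≡ y₃ → lab y₁ ≡ just u → ⊥
  ¬opposite-crossings {y₁ = y₁} {y₃ = y₃} {u} T₀ T₁ T₂ T₃ F₁ F₃ σ²y₁≡y₃ l₁ =
    irrefl (edge-sound y₁ l₁ lab-far)
    where
    far≡y₃ : farEnd σ α lab y₁ ≡ y₃
    far≡y₃ = begin
      farEnd σ α lab y₁ ≡⟨ farEnd-via-crossing y₁ F₁ ⟩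
      α (σ (σ (α y₁)))  ≡⟨ cong α (opposite-crossings-coincide T₀ T₁ T₂ T₃ F₁ F₃) ⟩
      α (α y₃)          ≡⟨ α-inv y₃ ⟩
      y₃                ∎

    lab-far : lab (farEnd σ α lab y₁) ≡ just u
    lab-far = begin
      lab (farEnd σ α lab y₁) ≡⟨ cong lab (trans far≡y₃ (sym σ²y₁≡y₃)) ⟩
      lab (iter σ 2 y₁)       ≡⟨ lab-iter-σ 2 y₁ ⟩
      lab y₁                  ≡⟨ l₁ ⟩
      just u                  ∎

  -- Every false triangle has a crossing and no two crossings are consecutive,
  -- so the crossings sit at α y₀, α y₂ or at α y₁, α y₃.
  ¬four-false-triangles : ∀ {x u} → lab x ≡ just u → σ (σ (σ (σ x))) ≡ x →
    FalseTriangleCorner (σ (σ (σ x))) x → FalseTriangleCorner x (σ x) →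
    FalseTriangleCorner (σ x) (σ (σ x)) → FalseTriangleCorner (σ (σ x)) (σ (σ (σ x))) → ⊥
  ¬four-false-triangles {x} lx σ⁴x≡x t₀ t₁ t₂ t₃ with crossing t₀
  ... | inj₁ F₀ = ¬opposite-crossings (triangle t₁) (triangle t₂) (triangle t₃) (triangle t₀)
                    (next-crossing t₁ t₂ F₀) F₀ σ⁴x≡x (trans (lab-iter-σ 2 x) lx)
  ... | inj₂ F₃ = ¬opposite-crossings (triangle t₀) (triangle t₁) (triangle t₂) (triangle t₃)
                    (previous-crossing t₂ t₃ F₃) F₃ refl (trans (lab-σ x) lx)

  incident-corner : ∀ {l x y} .{{_ : NonZero l}} → iter σ l x ≡ x → Incident x y →
                    Σ (Fin l) λ c → SameOrbit φ y (iter σ (toℕ c) x)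
  incident-corner P (m , k , e) with orbit-representative σ P (k , refl)
  ... | c , e′ = c , m , trans (sym e) (sym e′)

lemma2p1 : ∀ {n} (G : SimpleGraph n) (D : Drawing G) → IsOnePlane D →
    let open Drawing D in
    ∀ (x : Fin d) → TrueDart x → VertexDegree x 4 →
    ∀ (j : ℕ) (f : Fin j → Fin d) →
    (∀ i → Incident x (f i)) →
    (∀ i → FaceDegree (f i) 3) →
    (∀ i → FalseFace (f i)) →
    (∀ i i' → SameFace (f i) (f i') → i ≡ i') →
    j ≤ 3
lemma2p1 G D _ x tx (_ , σ⁴x≡x , _) j f inc deg false inj with is-just⇒just tx
... | _ , lx = [ (λ onto → ⊥-elim (¬four-false-triangles lx σ⁴x≡x
                     (false-triangle-at zero onto σ⁴x≡x)
                     (false-triangle-at (suc zero) onto refl)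
                     (false-triangle-at (suc (suc zero)) onto refl)
                     (false-triangle-at (suc (suc (suc zero))) onto refl)))
               , id ]′ (injective⇒surjective⊎≤ corner-of-injective)
  where
  open Drawing D
  open DrawingProperties D

  corner-dart : Fin 4 → Fin d
  corner-dart c = iter σ (toℕ c) x

  corner-of : Fin j → Fin 4
  corner-of i = proj₁ (incident-corner σ⁴x≡x (inc i))

  corner-on-face : ∀ i → SameOrbit φ (f i) (corner-dart (corner-of i))
  corner-on-face i = proj₂ (incident-corner σ⁴x≡x (inc i))

  corner-of-injective : Injective _≡_ _≡_ corner-of
  corner-of-injective {i} {i′} e = inj i i′ (sameOrbit-trans φ (corner-on-face i)
    (sameOrbit-sym φ {2} (proj₁ (proj₂ (deg i′)))
      (subst (λ c → SameOrbit φ (f i′) (corner-dart c)) (sym e) (corner-on-face i′))))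

  false-triangle-at : ∀ c → (∀ c → ∃ λ i → corner-of i ≡ c) →
                      ∀ {p} → σ p ≡ corner-dart c → FalseTriangleCorner p (corner-dart c)
  false-triangle-at c onto σp≡y with onto c
  ... | i , refl = false-3-face-corner (trans (lab-iter-σ (toℕ (corner-of i)) x) lx)
                     σp≡y (corner-on-face i) (deg i) (false i)
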